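{- Let $(\alpha_1,\beta_1),\dots,(\alpha_s,\beta_s)$ be pairs of indices such that for each $\ell$ there is $r_\ell\in\{1,\dots,k\}$ with $\{\alpha_\ell,\beta_\ell\}=\{2r_\ell-1,2r_\ell\}$, and $a_{\beta_\ell}=a_{\alpha_{\ell+1}}$ for $1\le\ell<s$ (so the edges $\overline{a_{\alpha_1}a_{\beta_1}},\dots,\overline{a_{\alpha_s}a_{\beta_s}}$ form a walk in $H$). Suppose $\vec T$ satisfies Condition 1 or Condition 3 at every internal vertex $a_{\beta_\ell}$, $1\le\ell<s$. Then there is a walk in $K$ from $v_{\alpha_1}$ to either $v_{\beta_s}$ or $w_{\beta_s}$, and there is a walk in $K$ from $w_{\alpha_1}$ to either $v_{\beta_s}$ or $w_{\beta_s}$.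
   Context: $H$ is a connected finite simple graph with no leaves, vertices $1,\dots,t$, $k$ edges, oriented arbitrarily with directed edges $\overrightarrow{a_1a_2},\dots,\overrightarrow{a_{2k-1}a_{2k}}$; $\Gamma(b)=\{i:a_i=b\}$. $G$ is a finite simple graph and $\vec G$ its symmetric digraph. $\vec T=(\vec T_1,\vec T_2)$ is a $2k$-tuple of edges of $\vec G$ with $\vec T_1=(\overrightarrow{v_1v_2},\dots,\overrightarrow{v_{2k-1}v_{2k}})$, $\vec T_2=(\overrightarrow{w_1w_2},\dots,\overrightarrow{w_{2k-1}w_{2k}})$. $K$ is the undirected subgraph of $G$ consisting of the edges $v_{2i-1}v_{2i}$ and $w_{2i-1}w_{2i}$, $1\le i\le k$. Conditions at $b$: Condition 1: the $v_i$, $i\in\Gamma(b)$, are all equal and the $w_i$, $i\in\Gamma(b)$, are all equal. Condition 3: there are vertices $x,y$ of $G$ such that for every $i\in\Gamma(b)$, either ($v_i=x$, $w_i=y$) or ($v_i=y$, $w_i=x$). -}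

module Defs where

open import Data.Nat using (ℕ)
open import Data.Fin using (Fin; zero; suc)
open import Data.Product using (Σ; ∃; _×_; _,_)
open import Data.Sum using (_⊎_)
open import Relation.Nullary using (¬_)
open import Relation.Binary.PropositionalEquality using (_≡_; _≢_)
open import Relation.Binary.Construct.Closure.ReflexiveTransitive using (Star)

-- Index of an endpoint of a directed edge of H.
-- The paper's index 2r-1 (tail of the r-th edge) is (r , zero),
-- and 2r (head of the r-th edge) is (r , suc zero).
Idx : ℕ → Set
Idx k = Fin k × Fin 2

tl hd : Fin 2
tl = zero
hd = suc zero

-- H : vertices Fin t, k directed edges; a : Idx k → Fin t gives the a_i.
-- Adjacency in the underlying undirected graph of H.
HAdj : {t k : ℕ} → (Idx k → Fin t) → Fin t → Fin t → Set
HAdj {t} {k} a x y =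
  ∃ λ (r : Fin k) → (a (r , tl) ≡ x × a (r , hd) ≡ y) ⊎ (a (r , hd) ≡ x × a (r , tl) ≡ y)

record GoodH (t k : ℕ) (a : Idx k → Fin t) : Set where
  field
    noLoops   : ∀ r → a (r , tl) ≢ a (r , hd)
    noMulti   : ∀ r r' → r ≢ r' →
                ¬ ((a (r , tl) ≡ a (r' , tl) × a (r , hd) ≡ a (r' , hd))
                   ⊎ (a (r , tl) ≡ a (r' , hd) × a (r , hd) ≡ a (r' , tl)))
    connected : ∀ x y → Star (HAdj a) x y
    noLeaves  : ∀ b r e → a (r , e) ≡ b →
                ∃ λ r' → r' ≢ r × ∃ λ e' → a (r' , e') ≡ b

record SimpleGraph (n : ℕ) : Set₁ where
  field
    E     : Fin n → Fin n → Set
    sym   : ∀ {x y} → E x y → E y x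
    irrfl : ∀ {x} → ¬ E x x
open SimpleGraph public

KAdj : {n k : ℕ} → (v w : Idx k → Fin n) → Fin n → Fin n → Set
KAdj {n} {k} v w x y = ∃ λ (r : Fin k) →
     ((v (r , tl) ≡ x × v (r , hd) ≡ y) ⊎ (v (r , hd) ≡ x × v (r , tl) ≡ y))
   ⊎ ((w (r , tl) ≡ x × w (r , hd) ≡ y) ⊎ (w (r , hd) ≡ x × w (r , tl) ≡ y))

KWalk : {n k : ℕ} → (v w : Idx k → Fin n) → Fin n → Fin n → Set
KWalk v w = Star (KAdj v w)

Cond1 : {t n k : ℕ} → (Idx k → Fin t) → (v w : Idx k → Fin n) → Fin t → Set
Cond1 a v w b = ∀ i j → a i ≡ b → a j ≡ b → v i ≡ v j × w i ≡ w j

Cond3 : {t n k : ℕ} → (Idx k → Fin t) → (v w : Idx k → Fin n) → Fin t → Set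
Cond3 {n = n} a v w b = ∃ λ (x : Fin n) → ∃ λ (y : Fin n) →
  ∀ i → a i ≡ b → (v i ≡ x × w i ≡ y) ⊎ (v i ≡ y × w i ≡ x)

-- Follow the walk α₁β₁, α₂β₂, … in H and keep track of the invariant "z reaches v_i or w_i in K".
-- Crossing an edge r of H, the edges v_{2r-1}v_{2r} and w_{2r-1}w_{2r} of K carry the invariant from
-- one end of r to the other.  At an internal vertex b, Condition 1 or 3 says that {v_i, w_i} ⊆ {v_j, w_j}
-- for any two indices i, j at b, so the invariant passes from β_ℓ to α_{ℓ+1}.  Applied with z = v_{α₁}
-- and z = w_{α₁} this gives both claims.
module Submission where

open import Defs hiding (sym)
open import Data.Nat using (ℕ; suc)
open import Data.Fin using (Fin; zero; suc; inject₁; fromℕ)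
open import Data.Product using (∃; _×_; _,_; proj₁; proj₂)
open import Data.Sum using (_⊎_; inj₁; inj₂)
open import Relation.Binary.PropositionalEquality using (_≡_; refl; sym; subst)
open import Relation.Binary.Construct.Closure.ReflexiveTransitive using (ε; _◅_; _◅◅_)

zigzag-induction : {m : ℕ} (P Q : Fin (suc m) → Set) → P zero → (∀ ℓ → P ℓ → Q ℓ) →
  (∀ (ℓ : Fin m) → Q (inject₁ ℓ) → P (suc ℓ)) → Q (fromℕ m)
zigzag-induction {ℕ.zero} P Q p₀ P⇒Q Q⇒P = P⇒Q zero p₀
zigzag-induction {suc m} P Q p₀ P⇒Q Q⇒P =
  P⇒Q (fromℕ (suc m)) (Q⇒P (fromℕ m)
    (zigzag-induction (λ ℓ → P (inject₁ ℓ)) (λ ℓ → Q (inject₁ ℓ)) p₀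
      (λ ℓ → P⇒Q (inject₁ ℓ)) (λ ℓ → Q⇒P (inject₁ ℓ))))

same-unordered-pair⇒⊆ : {A : Set} {x y p q p′ q′ : A} →
  (p ≡ x × q ≡ y) ⊎ (p ≡ y × q ≡ x) → (p′ ≡ x × q′ ≡ y) ⊎ (p′ ≡ y × q′ ≡ x) →
  (p ≡ p′ ⊎ p ≡ q′) × (q ≡ p′ ⊎ q ≡ q′)
same-unordered-pair⇒⊆ (inj₁ (refl , refl)) (inj₁ (refl , refl)) = inj₁ refl , inj₂ refl
same-unordered-pair⇒⊆ (inj₁ (refl , refl)) (inj₂ (refl , refl)) = inj₂ refl , inj₁ refl
same-unordered-pair⇒⊆ (inj₂ (refl , refl)) (inj₁ (refl , refl)) = inj₂ refl , inj₁ refl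
same-unordered-pair⇒⊆ (inj₂ (refl , refl)) (inj₂ (refl , refl)) = inj₁ refl , inj₂ refl

OppositeEnds : {k : ℕ} → Idx k → Idx k → Set
OppositeEnds {k} i j = ∃ λ (r : Fin k) → (i ≡ (r , tl) × j ≡ (r , hd)) ⊎ (i ≡ (r , hd) × j ≡ (r , tl))

module _ {n k : ℕ} (v w : Idx k → Fin n) where

  Reaches : Fin n → Idx k → Set
  Reaches z i = KWalk v w z (v i) ⊎ KWalk v w z (w i)

  ImagesCovered : Idx k → Idx k → Set
  ImagesCovered i j = (v i ≡ v j ⊎ v i ≡ w j) × (w i ≡ v j ⊎ w i ≡ w j)

  oppositeEnds⇒KAdj : ∀ {i j} → OppositeEnds i j → KAdj v w (v i) (v j) × KAdj v w (w i) (w j)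
  oppositeEnds⇒KAdj (r , inj₁ (refl , refl)) =
    (r , inj₁ (inj₁ (refl , refl))) , (r , inj₂ (inj₁ (refl , refl)))
  oppositeEnds⇒KAdj (r , inj₂ (refl , refl)) =
    (r , inj₁ (inj₂ (refl , refl))) , (r , inj₂ (inj₂ (refl , refl)))

  reaches-across-edge : ∀ {z i j} → OppositeEnds i j → Reaches z i → Reaches z j
  reaches-across-edge i~j (inj₁ p) = inj₁ (p ◅◅ (proj₁ (oppositeEnds⇒KAdj i~j) ◅ ε))
  reaches-across-edge i~j (inj₂ p) = inj₂ (p ◅◅ (proj₂ (oppositeEnds⇒KAdj i~j) ◅ ε))

  walk-to-image : ∀ {z u} j → u ≡ v j ⊎ u ≡ w j → KWalk v w z u → Reaches z j
  walk-to-image j (inj₁ u≡vj) p = inj₁ (subst (KWalk v w _) u≡vj p)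
  walk-to-image j (inj₂ u≡wj) p = inj₂ (subst (KWalk v w _) u≡wj p)

  reaches-covered : ∀ {z i j} → ImagesCovered i j → Reaches z i → Reaches z j
  reaches-covered {j = j} (vi∈ , _) (inj₁ p) = walk-to-image j vi∈ p
  reaches-covered {j = j} (_ , wi∈) (inj₂ p) = walk-to-image j wi∈ p

  module _ {t : ℕ} (a : Idx k → Fin t) where

    cond1⇒imagesCovered : ∀ {i j} → a i ≡ a j → Cond1 a v w (a i) → ImagesCovered i j
    cond1⇒imagesCovered {i} {j} ai≡aj c with c i j refl (sym ai≡aj)
    ... | vi≡vj , wi≡wj = inj₁ vi≡vj , inj₂ wi≡wj

    cond3⇒imagesCovered : ∀ {i j} → a i ≡ a j → Cond3 a v w (a i) → ImagesCovered i j
    cond3⇒imagesCovered {i} {j} ai≡aj (_ , _ , c) =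
      same-unordered-pair⇒⊆ (c i refl) (c j (sym ai≡aj))

    reaches-through-vertex : ∀ {z i j} → a i ≡ a j →
      Cond1 a v w (a i) ⊎ Cond3 a v w (a i) → Reaches z i → Reaches z j
    reaches-through-vertex ai≡aj (inj₁ c) = reaches-covered (cond1⇒imagesCovered ai≡aj c)
    reaches-through-vertex ai≡aj (inj₂ c) = reaches-covered (cond3⇒imagesCovered ai≡aj c)

lemma3p5 : (t k : ℕ) (a : Idx k → Fin t) → GoodH t k a →
    (n : ℕ) (G : SimpleGraph n) (v w : Idx k → Fin n) →
    (∀ r → E G (v (r , tl)) (v (r , hd))) →
    (∀ r → E G (w (r , tl)) (w (r , hd))) →
    (m : ℕ) (α β : Fin (suc m) → Idx k) →
    (∀ ℓ → ∃ λ r → (α ℓ ≡ (r , tl) × β ℓ ≡ (r , hd)) ⊎ (α ℓ ≡ (r , hd) × β ℓ ≡ (r , tl))) →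
    (∀ (ℓ : Fin m) → a (β (inject₁ ℓ)) ≡ a (α (suc ℓ))) →
    (∀ (ℓ : Fin m) → Cond1 a v w (a (β (inject₁ ℓ))) ⊎ Cond3 a v w (a (β (inject₁ ℓ)))) →
    (KWalk v w (v (α zero)) (v (β (fromℕ m))) ⊎ KWalk v w (v (α zero)) (w (β (fromℕ m))))
    × (KWalk v w (w (α zero)) (v (β (fromℕ m))) ⊎ KWalk v w (w (α zero)) (w (β (fromℕ m))))
lemma3p5 t k a _ n _ v w _ _ m α β edges joins conditions =
  along-walk (inj₁ ε) , along-walk (inj₂ ε)
  where
  along-walk : ∀ {z} → Reaches v w z (α zero) → Reaches v w z (β (fromℕ m))
  along-walk {z} reaches-start =
    zigzag-induction (λ ℓ → Reaches v w z (α ℓ)) (λ ℓ → Reaches v w z (β ℓ)) reaches-start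
      (λ ℓ → reaches-across-edge v w (edges ℓ))
      (λ ℓ → reaches-through-vertex v w a (joins ℓ) (conditions ℓ))
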